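{- For nonnegative integers $i,j$, say $i$ is free of $j$ if the binary expansion of $i$ has 0s in all positions where the binary expansion of $j$ has 1s, and let $b(n)$ denote the sum of the binary digits of $n$. For an indeterminate $x$, let $S(x)$ be the infinite lower-triangular matrix with $S(x)_{ij}=x^{b(i-j)}$ if $i\ge j\ge 0$ and $i-j$ is free of $j$, and $S(x)_{ij}=0$ otherwise. Then for every positive integer $q$, $$S(x)^{q}=S(qx).$$
   Context: Products of infinite lower-triangular matrices are defined by the usual formula, each entry being a finite sum; entries are polynomials in $x$. -}

module Defs where

open import Level using (Level)
open import Data.Bool using (Bool; true; false; not; _∧_; if_then_else_)
open import Data.Nat using (ℕ; zero; suc; _∸_; _≤ᵇ_; _≡ᵇ_; _%_; _/_)
import Data.Nat as ℕ
open import Algebra.Bundles using (CommutativeSemiring)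

-- Binary expansions (computed with fuel; fuel n suffices for n,
-- since n < 2^n, and extra iterations only see zero digits).

odd : ℕ → Bool
odd n = n % 2 ≡ᵇ 1

digitSumF : ℕ → ℕ → ℕ
digitSumF zero    n = 0
digitSumF (suc f) n = (if odd n then 1 else 0) ℕ.+ digitSumF f (n / 2)

b : ℕ → ℕ
b n = digitSumF n n

freeF : ℕ → ℕ → ℕ → Bool
freeF zero    i j = true
freeF (suc f) i j = not (odd i ∧ odd j) ∧ freeF f (i / 2) (j / 2)

isFreeOf : ℕ → ℕ → Bool
isFreeOf i j = freeF (i ℕ.+ j) i j

module _ {c ℓ : Level} (R : CommutativeSemiring c ℓ) where
  open CommutativeSemiring R

  Matrix : Set c
  Matrix = ℕ → ℕ → Carrier

  pow : Carrier → ℕ → Carrier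
  pow x zero    = 1#
  pow x (suc n) = x * pow x n

  scale : ℕ → Carrier → Carrier
  scale zero    x = 0#
  scale (suc q) x = x + scale q x

  sumTo : ℕ → (ℕ → Carrier) → Carrier
  sumTo zero    f = 0#
  sumTo (suc n) f = sumTo n f + f n

  -- product of lower-triangular matrices:
  -- (A B)_{ij} = Σ_{k=0}^{i} A_{ik} B_{kj}  (a finite sum; the omitted
  -- terms k > i vanish since A is lower triangular)
  mmul : Matrix → Matrix → Matrix
  mmul A B i j = sumTo (suc i) (λ k → A i k * B k j)

  -- M^(q+1)
  mpowSuc : Matrix → ℕ → Matrix
  mpowSuc M zero    = M
  mpowSuc M (suc q) = mmul M (mpowSuc M q)

  S : Carrier → Matrix
  S x i j = if (j ≤ᵇ i) ∧ isFreeOf (i ∸ j) j then pow x (b (i ∸ j)) else 0#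

  _≋_ : Matrix → Matrix → Set ℓ
  A ≋ B = ∀ i j → A i j ≈ B i j

module Submission where

-- Write row and column indices as i = 2n + a and j = 2m + c with lowest binary digits a, c.
-- Then S(x)_{ij} = S₂(x)_{ac} S(x)_{nm}, where S₂(x) = [[1,0],[x,1]]: S(x) is the infinite
-- Kronecker power of S₂(x), because "i − j is free of j" says exactly that the binary addition
-- of j and i − j has no carries. Splitting the sum defining (S(x) S(y))_{ij} by the parity of the summation
-- index and using S₂(x) S₂(y) = S₂(x + y) gives S(x) S(y) = S(x + y) by strong induction on i;
-- the corollary follows by induction on q.

open import Defs
open import Level using (Level)
open import Algebra.Bundles using (CommutativeSemiring)
open import Data.Bool using (Bool; true; false; not; _∧_; if_then_else_)
open import Data.Nat using (ℕ; zero; suc)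

module BinaryDigits where

  open import Data.Nat using (_+_; _*_; _/_; _≡ᵇ_; _≤_; _<_; z≤n; s≤s)
  open import Data.Nat.Properties
  open import Data.Nat.DivMod using (m*n/n≡m; m*n%n≡0; +-distrib-/-∣ʳ; [m+kn]%n≡m%n; m/n<m)
  open import Data.Nat.Divisibility using (divides-refl)
  open import Data.Nat.Solver using (module +-*-Solver)
  open import Relation.Binary.PropositionalEquality

  bit : Bool → ℕ → ℕ
  bit false n = n * 2
  bit true  n = suc (n * 2)

  data Binary : ℕ → Set where
    bits : ∀ a n → Binary (bit a n)

  binary : ∀ i → Binary i
  binary zero = bits false zero
  binary (suc i) with binary i
  ... | bits false n = bits true n
  ... | bits true  n = bits false (suc n)

  bit/2 : ∀ a n → bit a n / 2 ≡ n
  bit/2 false n = m*n/n≡m n 2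
  bit/2 true  n = trans (+-distrib-/-∣ʳ 1 {d = 2} (divides-refl n)) (m*n/n≡m n 2)

  odd-bit : ∀ a n → odd (bit a n) ≡ a
  odd-bit false n = cong (_≡ᵇ 1) (m*n%n≡0 n 2)
  odd-bit true  n = cong (_≡ᵇ 1) ([m+kn]%n≡m%n 1 n 2)

  n≤bit : ∀ a n → n ≤ bit a n
  n≤bit false n = m≤m*n n 2
  n≤bit true  n = m≤n⇒m≤1+n (m≤m*n n 2)

  bit<bit : ∀ a c {n m} → n < m → bit a n < bit c m
  bit<bit a c {n} {m} n<m = begin-strict
    bit a n      ≤⟨ bit≤bit-true a n ⟩
    suc (n * 2)  <⟨ n<1+n _ ⟩
    suc n * 2    ≤⟨ *-monoˡ-≤ 2 n<m ⟩
    m * 2        ≤⟨ bit-false≤bit c m ⟩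
    bit c m      ∎
    where
    open ≤-Reasoning
    bit≤bit-true : ∀ a n → bit a n ≤ bit true n
    bit≤bit-true false n = n≤1+n _
    bit≤bit-true true  n = ≤-refl
    bit-false≤bit : ∀ a n → bit false n ≤ bit a n
    bit-false≤bit false n = ≤-refl
    bit-false≤bit true  n = n≤1+n _

  /2≤ : ∀ {n f} → n ≤ suc f → n / 2 ≤ f
  /2≤ {zero}  _   = z≤n
  /2≤ {suc n} n≤1+f = ≤-pred (≤-trans (m/n<m (suc n) 2 (s≤s (s≤s z≤n))) n≤1+f)

  digitSumF-zero : ∀ f → digitSumF f 0 ≡ 0
  digitSumF-zero zero    = refl
  digitSumF-zero (suc f) = digitSumF-zero f

  digitSumF-fuel : ∀ n {f g} → n ≤ f → n ≤ g → digitSumF f n ≡ digitSumF g n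
  digitSumF-fuel n {zero}  {g}     z≤n _   = sym (digitSumF-zero g)
  digitSumF-fuel n {suc f} {zero}  n≤f z≤n = digitSumF-zero (suc f)
  digitSumF-fuel n {suc f} {suc g} n≤f n≤g =
    cong ((if odd n then 1 else 0) +_) (digitSumF-fuel (n / 2) (/2≤ n≤f) (/2≤ n≤g))

  b-bit : ∀ a n → b (bit a n) ≡ (if a then 1 else 0) + b n
  b-bit a n = begin
    digitSumF (bit a n) (bit a n)
      ≡⟨ digitSumF-fuel (bit a n) ≤-refl (n≤1+n _) ⟩
    digitSumF (suc (bit a n)) (bit a n)
      ≡⟨ cong₂ (λ d h → (if d then 1 else 0) + digitSumF (bit a n) h) (odd-bit a n) (bit/2 a n) ⟩
    (if a then 1 else 0) + digitSumF (bit a n) n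
      ≡⟨ cong ((if a then 1 else 0) +_) (digitSumF-fuel n (n≤bit a n) ≤-refl) ⟩
    (if a then 1 else 0) + b n
      ∎
    where open ≡-Reasoning

  freeF-zero : ∀ f → freeF f 0 0 ≡ true
  freeF-zero zero    = refl
  freeF-zero (suc f) = freeF-zero f

  freeF-fuel : ∀ i j {f g} → i ≤ f → j ≤ f → i ≤ g → j ≤ g → freeF f i j ≡ freeF g i j
  freeF-fuel i j {zero}  {g}     z≤n z≤n _   _   = sym (freeF-zero g)
  freeF-fuel i j {suc f} {zero}  _   _   z≤n z≤n = freeF-zero (suc f)
  freeF-fuel i j {suc f} {suc g} i≤f j≤f i≤g j≤g =
    cong (not (odd i ∧ odd j) ∧_) (freeF-fuel (i / 2) (j / 2) (/2≤ i≤f) (/2≤ j≤f) (/2≤ i≤g) (/2≤ j≤g))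

  isFreeOf-bit : ∀ a n c m → isFreeOf (bit a n) (bit c m) ≡ not (a ∧ c) ∧ isFreeOf n m
  isFreeOf-bit a n c m = begin
    freeF F (bit a n) (bit c m)
      ≡⟨ freeF-fuel (bit a n) (bit c m) i≤F j≤F (m≤n⇒m≤1+n i≤F) (m≤n⇒m≤1+n j≤F) ⟩
    freeF (suc F) (bit a n) (bit c m)
      ≡⟨ cong₂ (λ d e → not (d ∧ e) ∧ freeF F (bit a n / 2) (bit c m / 2)) (odd-bit a n) (odd-bit c m) ⟩
    not (a ∧ c) ∧ freeF F (bit a n / 2) (bit c m / 2)
      ≡⟨ cong₂ (λ u v → not (a ∧ c) ∧ freeF F u v) (bit/2 a n) (bit/2 c m) ⟩
    not (a ∧ c) ∧ freeF F n m
      ≡⟨ cong (not (a ∧ c) ∧_)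
              (freeF-fuel n m (≤-trans (n≤bit a n) i≤F) (≤-trans (n≤bit c m) j≤F) (m≤m+n n m) (m≤n+m m n)) ⟩
    not (a ∧ c) ∧ isFreeOf n m
      ∎
    where
    open ≡-Reasoning
    F = bit a n + bit c m
    i≤F : bit a n ≤ F
    i≤F = m≤m+n _ _
    j≤F : bit c m ≤ F
    j≤F = m≤n+m _ _

  bit-digit : ∀ a n → bit a n ≡ bit a 0 + n * 2
  bit-digit false n = refl
  bit-digit true  n = refl

  bit-+ : ∀ c m d k → bit c m + bit d k ≡ bit c 0 + bit d 0 + (m + k) * 2
  bit-+ c m d k rewrite bit-digit c m | bit-digit d k =
    solve 4 (λ c′ d′ m k → (c′ :+ m :* con 2) :+ (d′ :+ k :* con 2) := c′ :+ d′ :+ (m :+ k) :* con 2)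
      refl (bit c 0) (bit d 0) m k
    where open +-*-Solver

open BinaryDigits

module _ {c ℓ : Level} (R : CommutativeSemiring c ℓ) where

  open CommutativeSemiring R renaming (refl to ≈-refl; sym to ≈-sym; trans to ≈-trans) hiding (zero)
  open import Relation.Binary.Reasoning.Setoid setoid
  open import Algebra.Properties.CommutativeSemigroup *-commutativeSemigroup using (interchange)
  import Data.Nat as ℕ
  open import Data.Nat using (s≤s)
  import Data.Nat.Properties as ℕₚ
  open import Data.Nat.Properties using (≤⇒≤ᵇ; ≤ᵇ⇒≤; m≤m+n; <⇒≱; ≰⇒>; m+n∸m≡n; +-suc; n<1+n; m≤n⇒∃[o]m+o≡n)
  open import Data.Nat.Induction using (<-rec)
  open import Data.Product using (_,_)
  open import Relation.Nullary using (yes; no; contradiction)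
  open import Relation.Binary.PropositionalEquality as ≡ using (_≡_)

  sumTo-cong : ∀ n {f g : ℕ → Carrier} → (∀ k → f k ≈ g k) → sumTo R n f ≈ sumTo R n g
  sumTo-cong zero    f≈g = ≈-refl
  sumTo-cong (suc n) f≈g = +-cong (sumTo-cong n f≈g) (f≈g n)

  sumTo-*ˡ : ∀ n s (f : ℕ → Carrier) → sumTo R n (λ k → s * f k) ≈ s * sumTo R n f
  sumTo-*ˡ zero    s f = ≈-sym (zeroʳ s)
  sumTo-*ˡ (suc n) s f = ≈-trans (+-cong (sumTo-*ˡ n s f) ≈-refl) (≈-sym (distribˡ s _ _))

  sumTo-bits : ∀ n (f : ℕ → Carrier) →
               sumTo R (n ℕ.* 2) f ≈ sumTo R n (λ k → f (bit false k) + f (bit true k))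
  sumTo-bits zero    f = ≈-refl
  sumTo-bits (suc n) f = ≈-trans (+-assoc _ _ _) (+-cong (sumTo-bits n f) ≈-refl)

  pow-cong : ∀ {x y} → x ≈ y → ∀ n → pow R x n ≈ pow R y n
  pow-cong x≈y zero    = ≈-refl
  pow-cong x≈y (suc n) = *-cong x≈y (pow-cong x≈y n)

  S-cong : ∀ {x y} → x ≈ y → _≋_ R (S R x) (S R y)
  S-cong x≈y i j with (j ℕ.≤ᵇ i) ∧ isFreeOf (i ℕ.∸ j) j
  ... | true  = pow-cong x≈y (b (i ℕ.∸ j))
  ... | false = ≈-refl

  mmul-congʳ : ∀ A {B B′} → _≋_ R B B′ → _≋_ R (mmul R A B) (mmul R A B′)
  mmul-congʳ A B≋B′ i j = sumTo-cong (suc i) (λ k → *-cong ≈-refl (B≋B′ k j))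

  entry : Carrier → ℕ → ℕ → Carrier
  entry x t j = if isFreeOf t j then pow R x (b t) else 0#

  S-offset : ∀ x j t → S R x (j ℕ.+ t) j ≡ entry x t j
  S-offset x j t with j ℕ.≤ᵇ j ℕ.+ t | ≤⇒≤ᵇ (m≤m+n j t)
  ... | true | _ = ≡.cong (λ t′ → entry x t′ j) (m+n∸m≡n j t)

  entry-as-S : ∀ x j t → entry x t j ≈ S R x (j ℕ.+ t) j
  entry-as-S x j t = reflexive (≡.sym (S-offset x j t))

  S-above : ∀ x {i j} → i ℕ.< j → S R x i j ≡ 0#
  S-above x {i} {j} i<j with j ℕ.≤ᵇ i | ≤ᵇ⇒≤ j i
  ... | true  | j≤i = contradiction (j≤i _) (<⇒≱ i<j)
  ... | false | _   = ≡.refl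

  S-first-row : ∀ x y j → S R x 0 j ≡ S R y 0 j
  S-first-row x y zero    = ≡.refl
  S-first-row x y (suc j) = ≡.refl

  S₂ : Carrier → Bool → Bool → Carrier
  S₂ x false false = 1#
  S₂ x false true  = 0#
  S₂ x true  false = x
  S₂ x true  true  = 1#

  S₂-mul : ∀ x y a c → S₂ x a false * S₂ y false c + S₂ x a true * S₂ y true c ≈ S₂ (x + y) a c
  S₂-mul x y false false = ≈-trans (+-cong (*-identityˡ _) (zeroˡ _)) (+-identityʳ _)
  S₂-mul x y false true  = ≈-trans (+-cong (*-identityˡ _) (zeroˡ _)) (+-identityʳ _)
  S₂-mul x y true  false = +-cong (*-identityʳ x) (*-identityˡ y)
  S₂-mul x y true  true  = ≈-trans (+-cong (zeroʳ x) (*-identityˡ _)) (+-identityˡ _)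

  entry₂ : Carrier → Bool → Bool → Carrier
  entry₂ x false c     = 1#
  entry₂ x true  false = x
  entry₂ x true  true  = 0#

  entry-bit : ∀ x d k c m → entry x (bit d k) (bit c m) ≈ entry₂ x d c * entry x k m
  entry-bit x d k c m rewrite isFreeOf-bit d k c m | b-bit d k = factor d c (isFreeOf k m)
    where
    factor : ∀ d c free →
             (if not (d ∧ c) ∧ free then pow R x ((if d then 1 else 0) ℕ.+ b k) else 0#)
               ≈ entry₂ x d c * (if free then pow R x (b k) else 0#)
    factor false c     free  = ≈-sym (*-identityˡ _)
    factor true  true  free  = ≈-sym (zeroˡ _)
    factor true  false true  = ≈-refl
    factor true  false false = ≈-sym (zeroʳ x)

  S-offset-bit : ∀ x {i} c m d k → i ≡ bit c m ℕ.+ bit d k →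
                 S R x i (bit c m) ≈ entry₂ x d c * entry x k m
  S-offset-bit x {i} c m d k eq = begin
    S R x i (bit c m)                        ≡⟨ ≡.cong (λ i → S R x i (bit c m)) eq ⟩
    S R x (bit c m ℕ.+ bit d k) (bit c m)    ≡⟨ S-offset x (bit c m) (bit d k) ⟩
    entry x (bit d k) (bit c m)              ≈⟨ entry-bit x d k c m ⟩
    entry₂ x d c * entry x k m               ∎

  S-bit-offset : ∀ x a c m k → S R x (bit a (m ℕ.+ k)) (bit c m) ≈ S₂ x a c * S R x (m ℕ.+ k) m
  S-bit-offset x false false m k =
    ≈-trans (S-offset-bit x false m false k (≡.sym (bit-+ false m false k))) (*-cong ≈-refl (entry-as-S x m k))
  S-bit-offset x true true m k =
    ≈-trans (S-offset-bit x true m false k (≡.sym (bit-+ true m false k))) (*-cong ≈-refl (entry-as-S x m k))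
  S-bit-offset x true false m k =
    ≈-trans (S-offset-bit x false m true k (≡.sym (bit-+ false m true k))) (*-cong ≈-refl (entry-as-S x m k))
  S-bit-offset x false true m zero rewrite ℕₚ.+-identityʳ m = begin
    S R x (bit false m) (bit true m)  ≡⟨ S-above x (n<1+n (bit false m)) ⟩
    0#                                ≈⟨ zeroˡ _ ⟨
    0# * S R x m m                    ∎
  S-bit-offset x false true m (suc k) = begin
    S R x (bit false (m ℕ.+ suc k)) (bit true m) ≈⟨ S-offset-bit x true m true k eq ⟩
    0# * entry x k m                              ≈⟨ zeroˡ _ ⟩
    0#                                            ≈⟨ zeroˡ _ ⟨
    0# * S R x (m ℕ.+ suc k) m                    ∎
    where
    eq : bit false (m ℕ.+ suc k) ≡ bit true m ℕ.+ bit true k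
    eq = ≡.trans (≡.cong (ℕ._* 2) (+-suc m k)) (≡.sym (bit-+ true m true k))

  S-bit : ∀ x a n c m → S R x (bit a n) (bit c m) ≈ S₂ x a c * S R x n m
  S-bit x a n c m with m ℕ.≤? n
  ... | yes m≤n with m≤n⇒∃[o]m+o≡n m≤n
  ...   | k , ≡.refl = S-bit-offset x a c m k
  S-bit x a n c m | no m≰n = begin
    S R x (bit a n) (bit c m)  ≡⟨ S-above x (bit<bit a c n<m) ⟩
    0#                         ≈⟨ zeroʳ _ ⟨
    S₂ x a c * 0#              ≡⟨ ≡.cong (S₂ x a c *_) (S-above x n<m) ⟨
    S₂ x a c * S R x n m       ∎
    where n<m = ≰⇒> m≰n

  S-row-sum-extend : ∀ x a n (f : ℕ → Carrier) →
                     sumTo R (suc n ℕ.* 2) (λ k → S R x (bit a n) k * f k)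
                       ≈ sumTo R (suc (bit a n)) (λ k → S R x (bit a n) k * f k)
  S-row-sum-extend x true  n f = ≈-refl
  S-row-sum-extend x false n f = ≈-trans (+-cong ≈-refl beyond-diagonal) (+-identityʳ _)
    where
    beyond-diagonal : S R x (bit false n) (bit true n) * f (bit true n) ≈ 0#
    beyond-diagonal = ≈-trans (*-cong (reflexive (S-above x (n<1+n (bit false n)))) ≈-refl) (zeroˡ _)

  ProductRow : Carrier → Carrier → ℕ → Set ℓ
  ProductRow x y i = ∀ j → mmul R (S R x) (S R y) i j ≈ S R (x + y) i j

  S-mul-row-zero : ∀ x y → ProductRow x y 0
  S-mul-row-zero x y j =
    ≈-trans (+-identityˡ _) (≈-trans (*-identityˡ _) (reflexive (S-first-row y (x + y) j)))

  S-mul-row-bit : ∀ x y a n → ProductRow x y n → ProductRow x y (bit a n)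
  S-mul-row-bit x y a n row-n j with binary j
  ... | bits c m = begin
    sumTo R (suc (bit a n)) F                                  ≈⟨ S-row-sum-extend x a n _ ⟨
    sumTo R (suc n ℕ.* 2) F                                    ≈⟨ sumTo-bits (suc n) F ⟩
    sumTo R (suc n) (λ k → F (bit false k) + F (bit true k))   ≈⟨ sumTo-cong (suc n) digit-sum ⟩
    sumTo R (suc n) (λ k → s * G k)                            ≈⟨ sumTo-*ˡ (suc n) s G ⟩
    s * mmul R (S R x) (S R y) n m                             ≈⟨ *-cong (S₂-mul x y a c) (row-n m) ⟩
    S₂ (x + y) a c * S R (x + y) n m                           ≈⟨ S-bit (x + y) a n c m ⟨
    S R (x + y) (bit a n) (bit c m)                            ∎
    where
    F G : ℕ → Carrier
    F k = S R x (bit a n) k * S R y k (bit c m)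
    G k = S R x n k * S R y k m
    s : Carrier
    s = S₂ x a false * S₂ y false c + S₂ x a true * S₂ y true c
    digit-term : ∀ e k → F (bit e k) ≈ (S₂ x a e * S₂ y e c) * G k
    digit-term e k = ≈-trans (*-cong (S-bit x a n e k) (S-bit y e k c m)) (interchange _ _ _ _)
    digit-sum : ∀ k → F (bit false k) + F (bit true k) ≈ s * G k
    digit-sum k = ≈-trans (+-cong (digit-term false k) (digit-term true k)) (≈-sym (distribʳ _ _ _))

  S-mul : ∀ x y → _≋_ R (mmul R (S R x) (S R y)) (S R (x + y))
  S-mul x y = <-rec (ProductRow x y) row
    where
    row : ∀ i → (∀ {n} → n ℕ.< i → ProductRow x y n) → ProductRow x y i
    row i rec with binary i
    ... | bits false zero    = S-mul-row-zero x y
    ... | bits false (suc n) = S-mul-row-bit x y false (suc n) (rec (s≤s (s≤s (n≤bit false n))))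
    ... | bits true  n       = S-mul-row-bit x y true n (rec (s≤s (n≤bit false n)))

corollary3 : ∀ {c ℓ : Level} (R : CommutativeSemiring c ℓ)
    (x : CommutativeSemiring.Carrier R) (q : ℕ) →
    _≋_ R (mpowSuc R (S R x) q) (S R (scale R (suc q) x))
corollary3 R x zero    = S-cong R (sym (+-identityʳ x))
  where open CommutativeSemiring R
corollary3 R x (suc q) i j =
  trans (mmul-congʳ R (S R x) (corollary3 R x q) i j) (S-mul R x (scale R (suc q) x) i j)
  where open CommutativeSemiring R
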